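{- Let $\mathcal{K}\subseteq\mathsf{REL}$ and let $t,u,w$ be $\mathrm{PCoR}_{\{{}^*,\overline{\mathrm{I}},\overline{x}\}}$ terms. If $\mathcal{K}$ is submodel-closed and $\mathcal{K}\models w^{\circlearrowleft}\le T_{w^{\circlearrowleft}}(w^{\circlearrowleft})$, then $$\mathcal{K}_{w\ge\mathrm{I}}\models t\le u\quad\Longleftrightarrow\quad \mathcal{K}\models T_{w^{\circlearrowleft}}(t)\le u.$$
   Context: Variables form a countably infinite set $\mathbf{V}$. $\mathrm{PCoR}_{\{{}^*,\overline{\mathrm{I}},\overline{x}\}}$ terms are built from variables and constants $\mathrm{I}$ (identity), $0$, $\top$ (full relation), $\overline{\mathrm{I}}$ (complement of identity) using $;$, $+$ (union), $\cap$, ${}^{\smile}$ (converse), ${}^*$ (reflexive transitive closure), and complement $\overline{x}$ of variables; $t^{\circlearrowleft}:=t\cap\mathrm{I}$. A valuation $v$ over a nonempty set $B$ maps variables to binary relations on $B$, extended relationally to $\hat v$. $\mathsf{REL}$ is the class of all valuations. For a class $\mathcal{K}$, $\mathcal{K}\models t\le u$ means $\hat v(t)\subseteq\hat v(u)$ for all $v\in\mathcal{K}$; $\mathcal{K}_{w\ge\mathrm{I}}$ is the class of $v\in\mathcal{K}$ with $\hat v(\mathrm{I})\subseteq\hat v(w)$. For $v$ over $A$ and nonempty $B\subseteq A$, the submodel $v\restriction B$ maps each variable $x$ to $v(x)\cap B^2$; $\mathcal{K}$ is submodel-closed if $v\in\mathcal{K}$ implies $v\restriction B\in\mathcal{K}$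 for every nonempty subset $B$ of the base set of $v$. For terms $t$, $z$ define $T_z(t)$ by: $T_z(a)=z;a;z$ for $a$ a variable, a complemented variable $\overline{x}$, $\overline{\mathrm{I}}$, $\top$ or $\mathrm{I}$; $T_z(0)=0$; $T_z(t^{\smile})=T_z(t)^{\smile}$; $T_z(t\cap s)=T_z(t)\cap T_z(s)$; $T_z(t+s)=T_z(t)+T_z(s)$; $T_z(t;s)=T_z(t);T_z(s)$; $T_z(t^*)=T_z(t)^*;z$. -}

module Defs where

open import Level using (0ℓ)
open import Data.Nat using (ℕ)
open import Data.Empty using (⊥)
open import Data.Unit using (⊤)
open import Data.Sum using (_⊎_)
open import Data.Product using (Σ; ∃; _×_; proj₁; _,_)
open import Relation.Nullary using (¬_)
open import Relation.Binary using (Setoid)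
import Relation.Binary.Construct.On as On
open import Function.Bundles using (_⇔_)

Var : Set
Var = ℕ

infixl 6 _+ᵗ_
infixl 7 _∩ᵗ_
infixl 8 _⨾_
infix 9 _˘ _⋆

data Term : Set where
  var   : Var → Term
  cvar  : Var → Term
  Iᵗ    : Term
  0ᵗ    : Term
  ⊤ᵗ    : Term
  Īᵗ    : Term
  _⨾_   : Term → Term → Term
  _+ᵗ_  : Term → Term → Term
  _∩ᵗ_  : Term → Term → Term
  _˘    : Term → Term
  _⋆    : Term → Term

_↺ : Term → Term
t ↺ = t ∩ᵗ Iᵗ

T : Term → Term → Term
T z (var x)  = z ⨾ var x ⨾ z
T z (cvar x) = z ⨾ cvar x ⨾ z
T z Iᵗ       = z ⨾ Iᵗ ⨾ z
T z 0ᵗ       = 0ᵗ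
T z ⊤ᵗ       = z ⨾ ⊤ᵗ ⨾ z
T z Īᵗ       = z ⨾ Īᵗ ⨾ z
T z (t ⨾ s)  = T z t ⨾ T z s
T z (t +ᵗ s) = T z t +ᵗ T z s
T z (t ∩ᵗ s) = T z t ∩ᵗ T z s
T z (t ˘)    = T z t ˘
T z (t ⋆)    = (T z t ⋆) ⨾ z

-- Sets are modelled constructively as
-- setoids (the identity relation I is the setoid equality); binary relations
-- on B are predicates B → B → Set respecting that equality.
record Valuation : Set₁ where
  field
    base     : Setoid 0ℓ 0ℓ
  open Setoid base public
  field
    point    : Carrier                       -- B is nonempty
    val      : Var → Carrier → Carrier → Set
    val-resp : ∀ x {a a′ b b′} → a ≈ a′ → b ≈ b′ → val x a b → val x a′ b′

data Star {A : Set} (_≈_ : A → A → Set) (R : A → A → Set) : A → A → Set where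
  ε    : ∀ {a b} → a ≈ b → Star _≈_ R a b
  _◅_  : ∀ {a b c} → R a b → Star _≈_ R b c → Star _≈_ R a c

⟦_⟧ : Term → (v : Valuation) → Valuation.Carrier v → Valuation.Carrier v → Set
⟦ var x ⟧  v a b = Valuation.val v x a b
⟦ cvar x ⟧ v a b = ¬ Valuation.val v x a b
⟦ Iᵗ ⟧     v a b = Valuation._≈_ v a b
⟦ 0ᵗ ⟧     v a b = ⊥
⟦ ⊤ᵗ ⟧     v a b = ⊤
⟦ Īᵗ ⟧     v a b = ¬ Valuation._≈_ v a b
⟦ t ⨾ s ⟧  v a b = ∃ λ c → ⟦ t ⟧ v a c × ⟦ s ⟧ v c b
⟦ t +ᵗ s ⟧ v a b = ⟦ t ⟧ v a b ⊎ ⟦ s ⟧ v a b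
⟦ t ∩ᵗ s ⟧ v a b = ⟦ t ⟧ v a b × ⟦ s ⟧ v a b
⟦ t ˘ ⟧    v a b = ⟦ t ⟧ v b a
⟦ t ⋆ ⟧    v a b = Star (Valuation._≈_ v) (⟦ t ⟧ v) a b

Class : Set₂
Class = Valuation → Set₁

_⊨_≤_ : Class → Term → Term → Set₁
𝒦 ⊨ t ≤ u = ∀ v → 𝒦 v → ∀ a b → ⟦ t ⟧ v a b → ⟦ u ⟧ v a b

_[_≥I] : Class → Term → Class
(𝒦 [ w ≥I]) v = 𝒦 v × (∀ a b → ⟦ Iᵗ ⟧ v a b → ⟦ w ⟧ v a b)

-- Submodel v↾B for a nonempty subset B of the base (a predicate respecting
-- the identity of the base set, with a witness of nonemptiness).
restrict : (v : Valuation) (P : Valuation.Carrier v → Set) →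
           Σ (Valuation.Carrier v) P → Valuation
restrict v P (a₀ , p₀) = record
  { base     = On.setoid {B = Σ (Valuation.Carrier v) P} (Valuation.base v) proj₁
  ; point    = a₀ , p₀
  ; val      = λ x a b → Valuation.val v x (proj₁ a) (proj₁ b)
  ; val-resp = λ x → Valuation.val-resp v x
  }

SubmodelClosed : Class → Set₁
SubmodelClosed 𝒦 =
  ∀ v → 𝒦 v →
  (P : Valuation.Carrier v → Set) →
  (∀ {a b} → Valuation._≈_ v a b → P a → P b) →
  (ne : Σ (Valuation.Carrier v) P) →
  𝒦 (restrict v P ne)

module Submission where

-- Put z = w↺. Every T_z(t)-path runs between points of B = {c ∣ z c c}, and
-- restricted to the submodel v↾B it is a t-path, since the z's it inserts
-- are identities there. For "⇒", v↾B is in 𝒦 by submodel-closure and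
-- satisfies w ≥ I because z ≤ T_z(z) turns each c ∈ B into a z-loop of v↾B;
-- u transfers back from the submodel since u is evaluated pointwise. For
-- "⇐", w ≥ I makes B the whole base set, where t ≤ T_z(t) holds outright.

open import Defs
open import Function.Bundles using (_⇔_; mk⇔)
open import Data.Unit using (tt)
open import Data.Sum using (inj₁; inj₂)
open import Data.Product using (Σ; _×_; proj₁; proj₂; _,_)

module _ (v : Valuation) where
  open Valuation v

  Star-resp : ∀ {R : Carrier → Carrier → Set} →
    (∀ {a a′ b b′} → a ≈ a′ → b ≈ b′ → R a b → R a′ b′) →
    ∀ {a a′ b b′} → a ≈ a′ → b ≈ b′ → Star _≈_ R a b → Star _≈_ R a′ b′
  Star-resp R-resp a≈a′ b≈b′ (ε a≈b)   = ε (trans (sym a≈a′) (trans a≈b b≈b′))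
  Star-resp R-resp a≈a′ b≈b′ (r ◅ rs) = R-resp a≈a′ refl r ◅ Star-resp R-resp refl b≈b′ rs

  ⟦⟧-resp : ∀ t {a a′ b b′} → a ≈ a′ → b ≈ b′ → ⟦ t ⟧ v a b → ⟦ t ⟧ v a′ b′
  ⟦⟧-resp (var x)  a≈a′ b≈b′ h         = val-resp x a≈a′ b≈b′ h
  ⟦⟧-resp (cvar x) a≈a′ b≈b′ h         = λ r → h (val-resp x (sym a≈a′) (sym b≈b′) r)
  ⟦⟧-resp Iᵗ       a≈a′ b≈b′ a≈b       = trans (sym a≈a′) (trans a≈b b≈b′)
  ⟦⟧-resp 0ᵗ       a≈a′ b≈b′ ()
  ⟦⟧-resp ⊤ᵗ       a≈a′ b≈b′ h         = tt
  ⟦⟧-resp Īᵗ       a≈a′ b≈b′ a≉b       = λ a′≈b′ → a≉b (trans a≈a′ (trans a′≈b′ (sym b≈b′)))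
  ⟦⟧-resp (t ⨾ s)  a≈a′ b≈b′ (c , p , q) = c , ⟦⟧-resp t a≈a′ refl p , ⟦⟧-resp s refl b≈b′ q
  ⟦⟧-resp (t +ᵗ s) a≈a′ b≈b′ (inj₁ p)    = inj₁ (⟦⟧-resp t a≈a′ b≈b′ p)
  ⟦⟧-resp (t +ᵗ s) a≈a′ b≈b′ (inj₂ q)    = inj₂ (⟦⟧-resp s a≈a′ b≈b′ q)
  ⟦⟧-resp (t ∩ᵗ s) a≈a′ b≈b′ (p , q)     = ⟦⟧-resp t a≈a′ b≈b′ p , ⟦⟧-resp s a≈a′ b≈b′ q
  ⟦⟧-resp (t ˘)    a≈a′ b≈b′ h           = ⟦⟧-resp t b≈b′ a≈a′ h
  ⟦⟧-resp (t ⋆)    a≈a′ b≈b′ h           = Star-resp (⟦⟧-resp t) a≈a′ b≈b′ h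

module _ (v : Valuation) (P : Valuation.Carrier v → Set) (ne : Σ (Valuation.Carrier v) P) where
  open Valuation v

  restrict-reflects : ∀ u {x y} → ⟦ u ⟧ (restrict v P ne) x y → ⟦ u ⟧ v (proj₁ x) (proj₁ y)
  restrict-reflects (var x)  h           = h
  restrict-reflects (cvar x) h           = h
  restrict-reflects Iᵗ       h           = h
  restrict-reflects 0ᵗ       ()
  restrict-reflects ⊤ᵗ       h           = h
  restrict-reflects Īᵗ       h           = h
  restrict-reflects (s ⨾ r)  (c , p , q) = proj₁ c , restrict-reflects s p , restrict-reflects r q
  restrict-reflects (s +ᵗ r) (inj₁ p)    = inj₁ (restrict-reflects s p)
  restrict-reflects (s +ᵗ r) (inj₂ q)    = inj₂ (restrict-reflects r q)
  restrict-reflects (s ∩ᵗ r) (p , q)     = restrict-reflects s p , restrict-reflects r q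
  restrict-reflects (s ˘)    h           = restrict-reflects s h
  restrict-reflects (s ⋆)    h           = reflect⋆ h
    where
    reflect⋆ : ∀ {x y} → ⟦ s ⋆ ⟧ (restrict v P ne) x y → ⟦ s ⋆ ⟧ v (proj₁ x) (proj₁ y)
    reflect⋆ (ε x≈y)  = ε x≈y
    reflect⋆ (r ◅ rs) = restrict-reflects s r ◅ reflect⋆ rs

module Coreflexive (v : Valuation) (z : Term)
                   (z⊆I : ∀ {a b} → ⟦ z ⟧ v a b → Valuation._≈_ v a b) where
  open Valuation v

  Dom : Carrier → Set
  Dom c = ⟦ z ⟧ v c c

  Dom-resp : ∀ {a b} → a ≈ b → Dom a → Dom b
  Dom-resp a≈b = ⟦⟧-resp v z a≈b a≈b

  Dom-source : ∀ {a b} → ⟦ z ⟧ v a b → Dom a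
  Dom-source zab = ⟦⟧-resp v z refl (sym (z⊆I zab)) zab

  Dom-target : ∀ {a b} → ⟦ z ⟧ v a b → Dom b
  Dom-target zab = ⟦⟧-resp v z (z⊆I zab) refl zab

  sandwich : ∀ t {a b c d} → ⟦ z ⟧ v a c → ⟦ t ⟧ v c d → ⟦ z ⟧ v d b → ⟦ t ⟧ v a b
  sandwich t zac h zdb = ⟦⟧-resp v t (sym (z⊆I zac)) (z⊆I zdb) h

  T-endpoints : ∀ s {a b} → ⟦ T z s ⟧ v a b → Dom a × Dom b
  T-endpoints (var x)  (_ , (_ , zac , _) , zdb) = Dom-source zac , Dom-target zdb
  T-endpoints (cvar x) (_ , (_ , zac , _) , zdb) = Dom-source zac , Dom-target zdb
  T-endpoints Iᵗ       (_ , (_ , zac , _) , zdb) = Dom-source zac , Dom-target zdb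
  T-endpoints 0ᵗ       ()
  T-endpoints ⊤ᵗ       (_ , (_ , zac , _) , zdb) = Dom-source zac , Dom-target zdb
  T-endpoints Īᵗ       (_ , (_ , zac , _) , zdb) = Dom-source zac , Dom-target zdb
  T-endpoints (s ⨾ r)  (_ , p , q)               = proj₁ (T-endpoints s p) , proj₂ (T-endpoints r q)
  T-endpoints (s +ᵗ r) (inj₁ p)                  = T-endpoints s p
  T-endpoints (s +ᵗ r) (inj₂ q)                  = T-endpoints r q
  T-endpoints (s ∩ᵗ r) (p , _)                   = T-endpoints s p
  T-endpoints (s ˘)    h                         = proj₂ (T-endpoints s h) , proj₁ (T-endpoints s h)
  T-endpoints (s ⋆)    (_ , ε d≈a , zdb)         = Dom-resp (sym d≈a) (Dom-source zdb) , Dom-target zdb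
  T-endpoints (s ⋆)    (_ , r ◅ _ , zdb)         = proj₁ (T-endpoints s r) , Dom-target zdb

  module Submodel (ne : Σ Carrier Dom) where
    v↾ : Valuation
    v↾ = restrict v Dom ne

    T-restrict : ∀ s {a b} → ⟦ T z s ⟧ v a b → (pa : Dom a) (pb : Dom b) → ⟦ s ⟧ v↾ (a , pa) (b , pb)
    T-restrict (var x)  (_ , (_ , zac , h) , zdb) pa pb = sandwich (var x) zac h zdb
    T-restrict (cvar x) (_ , (_ , zac , h) , zdb) pa pb = sandwich (cvar x) zac h zdb
    T-restrict Iᵗ       (_ , (_ , zac , h) , zdb) pa pb = sandwich Iᵗ zac h zdb
    T-restrict 0ᵗ       ()
    T-restrict ⊤ᵗ       h                         pa pb = tt
    T-restrict Īᵗ       (_ , (_ , zac , h) , zdb) pa pb = sandwich Īᵗ zac h zdb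
    T-restrict (s ⨾ r)  (c , p , q) pa pb =
      let pc = proj₂ (T-endpoints s p) in (c , pc) , T-restrict s p pa pc , T-restrict r q pc pb
    T-restrict (s +ᵗ r) (inj₁ p) pa pb = inj₁ (T-restrict s p pa pb)
    T-restrict (s +ᵗ r) (inj₂ q) pa pb = inj₂ (T-restrict r q pa pb)
    T-restrict (s ∩ᵗ r) (p , q)  pa pb = T-restrict s p pa pb , T-restrict r q pa pb
    T-restrict (s ˘)    h        pa pb = T-restrict s h pb pa
    T-restrict (s ⋆) {b = b} (_ , steps , zdb) pa pb = restrict⋆ steps (z⊆I zdb) pa
      where
      restrict⋆ : ∀ {a d} → ⟦ T z s ⋆ ⟧ v a d → d ≈ b → (pa : Dom a) → ⟦ s ⋆ ⟧ v↾ (a , pa) (b , pb)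
      restrict⋆ (ε a≈d)  d≈b pa = ε (trans a≈d d≈b)
      restrict⋆ (r ◅ rs) d≈b pa =
        let pc = proj₂ (T-endpoints s r) in T-restrict s r pa pc ◅ restrict⋆ rs d≈b pc

  T-complete : (∀ c → Dom c) → ∀ t {a b} → ⟦ t ⟧ v a b → ⟦ T z t ⟧ v a b
  T-complete total (var x)  {a} {b} h = b , (a , total a , h) , total b
  T-complete total (cvar x) {a} {b} h = b , (a , total a , h) , total b
  T-complete total Iᵗ       {a} {b} h = b , (a , total a , h) , total b
  T-complete total 0ᵗ       ()
  T-complete total ⊤ᵗ       {a} {b} h = b , (a , total a , h) , total b
  T-complete total Īᵗ       {a} {b} h = b , (a , total a , h) , total b
  T-complete total (s ⨾ r)  (c , p , q) = c , T-complete total s p , T-complete total r q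
  T-complete total (s +ᵗ r) (inj₁ p)    = inj₁ (T-complete total s p)
  T-complete total (s +ᵗ r) (inj₂ q)    = inj₂ (T-complete total r q)
  T-complete total (s ∩ᵗ r) (p , q)     = T-complete total s p , T-complete total r q
  T-complete total (s ˘)    h           = T-complete total s h
  T-complete total (s ⋆) {b = b} h      = b , complete⋆ h , total b
    where
    complete⋆ : ∀ {a d} → ⟦ s ⋆ ⟧ v a d → ⟦ T z s ⋆ ⟧ v a d
    complete⋆ (ε a≈d)  = ε a≈d
    complete⋆ (r ◅ rs) = T-complete total s r ◅ complete⋆ rs

theorem31 : (𝒦 : Class) (t u w : Term) →
    SubmodelClosed 𝒦 →
    𝒦 ⊨ (w ↺) ≤ T (w ↺) (w ↺) →
    ((𝒦 [ w ≥I]) ⊨ t ≤ u) ⇔ (𝒦 ⊨ T (w ↺) t ≤ u)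
theorem31 𝒦 t u w closed z≤Tzz = mk⇔ to from
  where
  to : (𝒦 [ w ≥I]) ⊨ t ≤ u → 𝒦 ⊨ T (w ↺) t ≤ u
  to t≤u v v∈𝒦 a b h =
    restrict-reflects v Dom (a , pa) u (t≤u v↾ (v↾∈𝒦 , w≥I) (a , pa) (b , pb) (T-restrict t h pa pb))
    where
    open Coreflexive v (w ↺) proj₂
    pa : Dom a
    pa = proj₁ (T-endpoints t h)
    pb : Dom b
    pb = proj₂ (T-endpoints t h)
    open Submodel (a , pa)
    v↾∈𝒦 : 𝒦 v↾
    v↾∈𝒦 = closed v v∈𝒦 Dom Dom-resp (a , pa)
    w≥I : ∀ x y → ⟦ Iᵗ ⟧ v↾ x y → ⟦ w ⟧ v↾ x y
    w≥I (c , pc) y c≈y = ⟦⟧-resp v↾ w (Valuation.refl v) c≈y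
      (proj₁ (T-restrict (w ↺) (z≤Tzz v v∈𝒦 c c pc) pc pc))
  from : 𝒦 ⊨ T (w ↺) t ≤ u → (𝒦 [ w ≥I]) ⊨ t ≤ u
  from Tt≤u v (v∈𝒦 , w≥I) a b h = Tt≤u v v∈𝒦 a b (T-complete (λ c → w≥I c c refl , refl) t h)
    where
    open Valuation v using (refl)
    open Coreflexive v (w ↺) proj₂
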